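{- In the setting described in the context, fix $u\in V$ and let $\eta \in S(u)$. Then: (1) $\eta \in E(T^*_u)$; (2) $\mathrm{reach}_{T^*_u} (\eta^-) \geq \frac{1}{7} d_u (\eta)$; (3) there exists a descending path $P \subseteq T^*_u$ such that $\eta = \arg\min_{e \in P} \rho(e)$ and $|P| \geq \frac{2}{7} d_u (\eta)$. Furthermore, for any edge $\eta \in E$ satisfying (1) and (3), the following hold: (4) there exists a descending path $P \subseteq T^*_u$ such that $\eta = \arg\min_{e \in P} \rho(e)$, $\eta$ is one of the two extremal edges of $P$ (i.e., $P^+=\eta^+$ or $P^-=\eta^-$), and $|P| = \lceil \frac{1}{7} d_u (\eta) \rceil$; (5) there exists a descending path $P_u(x,y)$, for some $y \in V^*_u$ and $x\in V^*_u$ satisfying $d_u(x) = \lfloor\frac{7}{8}d_u(y)\rfloor$, such that $\eta = \arg\min_{e \in P_u(x,y)} \rho(e)$ and $\eta$ is one of the two extremal edges of $P_u(x,y)$.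
   Context: Let $G=(V\cup V^+,E)$ be a finite unweighted graph with a distinguished set $V$ of terminal nodes, in which every node of $V^+$ has degree $2$. Each $u\in V$ is associated with a fixed tree $T_u\subseteq G$, rooted at $u$ and containing all nodes of $V$. For nodes $v,w$ of $T_u$, $P_u(v,w)$ is the unique path between $v$ and $w$ in $T_u$, $P_u(v):=P_u(u,v)$, $|P|$ denotes the number of edges of a path $P$, and $d_u(v):=|P_u(v)|$. It is assumed that $P_u(v)=P_v(u)$ for all $u,v\in V$, and that $|P_u(v,w)|$ is an integer multiple of $12$ for all $u,v,w\in V$. Orient $T_u$ from the root to the leaves. A path $P\subseteq T_u$ is descending if one of its endpoints is a descendant of the other; $P^+$ and $P^-$ denote its endpoints closest to and furthest from $u$. For an edge $e$ of $T_u$, $e^+$ and $e^-$ denote its endpoints with $d_u(e^-)=d_u(e^+)+1$, and $d_u(e):=d_u(e^-)$. For a subtree $T$ of $T_u$ containing $v$, $\mathrm{reach}_T(v)$ is the maximum of $d_u(x)-d_u(v)$ over descendants $x$ of $v$ in $T$ (including $v$). The skeleton is $T_u^*:=T_u[V_u^*]$ with $V_u^*:=\{v\in V(T_u): \mathrm{reach}_{T_u}(v)\ge \tfrac12 d_u(v)\}$. Random hub construction: each edge $e\in E$ receives a value $\rho(e)\in[0,1]$ uniformly and independently at random, and we condition on all these values being distinct. For $u,v\in V$, $v\ne u$, the central subpath is $P_u'(v):=P_u(u',v')$, where $u',v'\in P_u(v)$ satisfy $d_u(u')=\tfrac{5}{12}d_u(v)$ and $d_u(v')=\tfrac{7}{12}d_u(v)$;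 $\eta_u(v):=\arg\min_{e\in P_u'(v)}\rho(e)$; and $S(u):=\{\eta_u(v): v\in V, v\ne u\}$. For a path $P$, $\eta=\arg\min_{e\in P}\rho(e)$ means $\eta\in P$ and $\eta$ has the minimum $\rho$-value among edges of $P$.
   Formalization: The edge values $\rho(e)$ are rational rather than real. -}

module Defs where

open import Data.Nat using (ℕ; zero; suc; _+_; _*_; _∸_; _≤_; _<_)
open import Data.Nat.Divisibility using (_∣_)
open import Data.Nat.DivMod using (_/_)
open import Data.Fin using (Fin)
open import Data.Bool using (Bool; true; false; if_then_else_)
open import Data.List using (List; map; allFin)
open import Data.Nat.ListAction using (sum)
open import Data.Product using (Σ; _×_; _,_)
open import Data.Sum using (_⊎_)
open import Relation.Binary.PropositionalEquality using (_≡_; _≢_)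
open import Data.Rational using (ℚ; 0ℚ; 1ℚ) renaming (_≤_ to _≤ℚ_)

iter : {A : Set} → ℕ → (A → A) → A → A
iter zero f x = x
iter (suc k) f x = f (iter k f x)

degree : ∀ {n} → (Fin n → Fin n → Bool) → Fin n → ℕ
degree {n} adj x = sum (map (λ y → if adj x y then 1 else 0) (allFin n))

-- The setting: a finite simple graph on the vertex set Fin n = V ∪ V⁺,
-- terminal x ≡ true  iff  x ∈ V; for each u ∈ V a rooted tree T_u ⊆ G,
-- encoded by its vertex set (inT u), parent map (parent u) and depth (depth u = d_u).
-- The edges of T_u are exactly {x , parent u x} for x ∈ V(T_u), x ≠ u.
record Setting (n : ℕ) : Set where
  field
    adj        : Fin n → Fin n → Bool
    adj-sym    : ∀ x y → adj x y ≡ adj y x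
    adj-irrefl : ∀ x → adj x x ≡ false
    terminal   : Fin n → Bool
    deg2       : ∀ x → terminal x ≡ false → degree adj x ≡ 2
    inT        : Fin n → Fin n → Bool
    parent     : Fin n → Fin n → Fin n
    depth      : Fin n → Fin n → ℕ
    root-in    : ∀ u → terminal u ≡ true → inT u u ≡ true
    root-depth : ∀ u → terminal u ≡ true → depth u u ≡ 0
    V⊆T        : ∀ u → terminal u ≡ true → ∀ v → terminal v ≡ true → inT u v ≡ true
    parent-ok  : ∀ u → terminal u ≡ true → ∀ x → inT u x ≡ true → x ≢ u →
                 (inT u (parent u x) ≡ true) × (adj x (parent u x) ≡ true)
                 × (depth u x ≡ suc (depth u (parent u x)))

module _ {n : ℕ} (G : Setting n) where
  open Setting G

  Anc : Fin n → Fin n → Fin n → Set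
  Anc u a b = (inT u a ≡ true) × (inT u b ≡ true) × (depth u a ≤ depth u b)
              × (iter (depth u b ∸ depth u a) (parent u) b ≡ a)

  IsLCA : Fin n → Fin n → Fin n → Fin n → Set
  IsLCA u c v w = Anc u c v × Anc u c w
                  × (∀ c' → Anc u c' v → Anc u c' w → depth u c' ≤ depth u c)

  -- {x , y} is an edge of the descending path P_u(a,b) (a ancestor of b), x the lower endpoint
  EdgeOnDown : Fin n → Fin n → Fin n → Fin n → Fin n → Set
  EdgeOnDown u a b x y = Anc u a x × Anc u x b × (x ≢ a) × (y ≡ parent u x)

  PathEdge : Fin n → Fin n → Fin n → Fin n → Fin n → Set
  PathEdge u a b x y = EdgeOnDown u a b x y ⊎ EdgeOnDown u a b y x

  record TreeAssumptions : Set where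
    field
      -- |P_u(v,w)| = d_u(v) + d_u(w) - 2 d_u(lca) is a multiple of 12
      mult12 : ∀ u v w → terminal u ≡ true → terminal v ≡ true → terminal w ≡ true →
               ∀ c → IsLCA u c v w → 12 ∣ (depth u v + depth u w ∸ 2 * depth u c)
      symPaths : ∀ u v → terminal u ≡ true → terminal v ≡ true → ∀ x y →
                 (PathEdge u u v x y → PathEdge v v u x y)
                 × (PathEdge v v u x y → PathEdge u u v x y)

  -- x is a descendant of v (or x ≡ v) in the subtree of T_u induced by S
  DescIn : Fin n → (Fin n → Set) → Fin n → Fin n → Set
  DescIn u S v x = Anc u v x × (∀ z → Anc u v z → Anc u z x → S z)

  -- reach_T(v) ≡ r, T the subtree of T_u induced on S
  Reach : Fin n → (Fin n → Set) → Fin n → ℕ → Set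
  Reach u S v r = (Σ (Fin n) λ x → DescIn u S v x × (depth u x ∸ depth u v ≡ r))
                  × (∀ x → DescIn u S v x → depth u x ∸ depth u v ≤ r)

  InTu : Fin n → Fin n → Set
  InTu u x = inT u x ≡ true

  Star : Fin n → Fin n → Set
  Star u v = InTu u v × (∀ r → Reach u (InTu u) v r → depth u v ≤ 2 * r)

  -- the tree edge of T_u with lower endpoint c (η⁻ = c, η⁺ = parent u c)
  TreeEdge : Fin n → Fin n → Set
  TreeEdge u c = InTu u c × (c ≢ u)

  StarEdge : Fin n → Fin n → Set
  StarEdge u c = TreeEdge u c × Star u c × Star u (parent u c)

  InPath : Fin n → Fin n → Fin n → Fin n → Set
  InPath u a b c = Anc u a c × Anc u c b × (c ≢ a)

  DescPathStar : Fin n → Fin n → Fin n → Set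
  DescPathStar u a b = Anc u a b × (∀ z → Anc u a z → Anc u z b → Star u z)

  module _ (ρ : Fin n → Fin n → ℚ) where

    ρT : Fin n → Fin n → ℚ
    ρT u c = ρ c (parent u c)

    ArgMin : Fin n → Fin n → Fin n → Fin n → Set
    ArgMin u a b c = InPath u a b c × (∀ c' → InPath u a b c' → ρT u c ≤ℚ ρT u c')

    -- edge with lower endpoint c lies on the central subpath P'_u(v)
    -- (d_u(u') = 5 d_u(v)/12 < d_u(c) and d_u(c) ≤ 7 d_u(v)/12 = d_u(v'))
    InCentral : Fin n → Fin n → Fin n → Set
    InCentral u v c = Anc u c v × (5 * depth u v < 12 * depth u c)
                      × (12 * depth u c ≤ 7 * depth u v)

    InS : Fin n → Fin n → Set
    InS u c = Σ (Fin n) λ v → (terminal v ≡ true) × (v ≢ u) × InCentral u v c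
              × (∀ c' → InCentral u v c' → ρT u c ≤ℚ ρT u c')

    Cond3 : Fin n → Fin n → Set
    Cond3 u c = Σ (Fin n) λ a → Σ (Fin n) λ b → DescPathStar u a b × ArgMin u a b c
                × (2 * depth u c ≤ 7 * (depth u b ∸ depth u a))

    -- property (4); ⌈ d / 7 ⌉ = (d + 6) / 7
    Cond4 : Fin n → Fin n → Set
    Cond4 u c = Σ (Fin n) λ a → Σ (Fin n) λ b → DescPathStar u a b × ArgMin u a b c
                × ((parent u c ≡ a) ⊎ (c ≡ b))
                × (depth u b ∸ depth u a ≡ (depth u c + 6) / 7)

    Cond5 : Fin n → Fin n → Set
    Cond5 u c = Σ (Fin n) λ x → Σ (Fin n) λ y → Star u x × Star u y
                × (depth u x ≡ (7 * depth u y) / 8)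
                × Anc u x y × ArgMin u x y c
                × ((parent u c ≡ x) ⊎ (c ≡ y))

record EdgeValues {n : ℕ} (G : Setting n) (ρ : Fin n → Fin n → ℚ) : Set where
  open Setting G
  field
    ρ-sym   : ∀ x y → ρ x y ≡ ρ y x
    ρ-range : ∀ x y → adj x y ≡ true → (0ℚ ≤ℚ ρ x y) × (ρ x y ≤ℚ 1ℚ)
    ρ-inj   : ∀ a b c d → adj a b ≡ true → adj c d ≡ true → ρ a b ≡ ρ c d →
              ((a ≡ c) × (b ≡ d)) ⊎ ((a ≡ d) × (b ≡ c))

module Submission where

-- Let η = η_u(v) with d_u(v) = 12q. The central subpath P'_u(v) is the segment of P_u(v)
-- between depths 5q and 7q, and every vertex of P_u(v) of depth at most 8q has v as a
-- descendant at distance at least half its own depth, hence lies in V*_u. So the segment from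
-- depth 5q to 7q is a path as in (3), and the segment from η down to depth 8q gives (2).
-- For (4) and (5), cut out of the path of (3) a subpath of the required length having η as
-- its last edge if the path reaches far enough above η, and as its first edge otherwise; a
-- subpath of a path in T*_u lies in T*_u and keeps η as its argmin.

open import Defs
open import Data.Nat using (ℕ; zero; suc; pred; _+_; _*_; _∸_; _≤_; _<_; z≤n; s≤s; NonZero; _≤?_)
open import Data.Nat.Properties hiding (_≟_)
open import Data.Nat.DivMod
  using (_/_; m≡m%n+[m/n]*n; m%n<n; m/n*n≤m; m*n/n≡m; /-monoˡ-≤; m<n*o⇒m/o<n; m≥n⇒m/n>0)
open import Data.Nat.Divisibility using (_∣_; divides)
open import Data.Nat.Tactic.RingSolver using (solve-∀)
open import Data.Fin using (Fin)
open import Data.Fin.Properties using (_≟_)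
open import Data.Bool using (true)
open import Data.Product using (_×_; _,_; proj₁; proj₂)
open import Data.Sum using (inj₁; inj₂)
open import Data.Rational using (ℚ)
open import Relation.Nullary using (¬_; yes; no; contradiction)
open import Relation.Binary.PropositionalEquality

n<[1+n/k]*k : ∀ n k .{{_ : NonZero k}} → n < suc (n / k) * k
n<[1+n/k]*k n k =
  subst (_< k + n / k * k) (sym (m≡m%n+[m/n]*n n k)) (+-monoˡ-< (n / k * k) (m%n<n n k))

/-≡-intro : ∀ n k q .{{_ : NonZero k}} → q * k ≤ n → n < suc q * k → n / k ≡ q
/-≡-intro n k q lo hi =
  ≤-antisym (≤-pred (m<n*o⇒m/o<n hi)) (subst (_≤ n / k) (m*n/n≡m q k) (/-monoˡ-≤ k lo))

3a≤2b∧b∸a≤r⇒a≤2r : ∀ {a b r} → 3 * a ≤ 2 * b → b ∸ a ≤ r → a ≤ 2 * r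
3a≤2b∧b∸a≤r⇒a≤2r {a} {b} {r} 3a≤2b b∸a≤r = +-cancelʳ-≤ (2 * a) a (2 * r) (begin
  3 * a              ≤⟨ 3a≤2b ⟩
  2 * b              ≤⟨ *-monoʳ-≤ 2 (m≤n+m∸n b a) ⟩
  2 * (a + (b ∸ a))  ≤⟨ *-monoʳ-≤ 2 (+-monoʳ-≤ a b∸a≤r) ⟩
  2 * (a + r)        ≡⟨ *-distribˡ-+ 2 a r ⟩
  2 * a + 2 * r      ≡⟨ +-comm (2 * a) (2 * r) ⟩
  2 * r + 2 * a      ∎)
  where open ≤-Reasoning

∸-+-∸ : ∀ {i j k} → i ≤ j → j ≤ k → (j ∸ i) + (k ∸ j) ≡ k ∸ i
∸-+-∸ {i} {j} {k} i≤j j≤k = begin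
  (j ∸ i) + (k ∸ j)  ≡⟨ +-comm (j ∸ i) (k ∸ j) ⟩
  (k ∸ j) + (j ∸ i)  ≡⟨ +-∸-assoc (k ∸ j) i≤j ⟨
  (k ∸ j) + j ∸ i    ≡⟨ cong (_∸ i) (m∸n+n≡m j≤k) ⟩
  k ∸ i              ∎
  where open ≡-Reasoning

-- Below, ⌈x/7⌉ stands for (x + 6) / 7. Most bounds are proved by contradiction: the negation
-- and the hypotheses, scaled and added up, give an inequality of the shape n + suc k ≤ n.
≡+suc⇒≰ : ∀ {m n} k → m ≡ n + suc k → ¬ m ≤ n
≡+suc⇒≰ {n = n} k refl = m+1+n≰m n

⌊7D/8⌋<D : ∀ {D} → 0 < D → 7 * D / 8 < D
⌊7D/8⌋<D {D} 0<D = m<n*o⇒m/o<n (subst (7 * D <_) (*-comm 8 D) (+-monoˡ-< (7 * D) 0<D))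

1≤⌈D/7⌉ : ∀ {D} → 1 ≤ D → 1 ≤ (D + 6) / 7
1≤⌈D/7⌉ {D} 1≤D = m≥n⇒m/n>0 (+-monoˡ-≤ 6 1≤D)

s+⌈D/7⌉≤a+L : ∀ {D} s a L → D ≡ suc s → 2 * D ≤ 7 * L → D < a + (D + 6) / 7 →
              s + (D + 6) / 7 ≤ a + L
s+⌈D/7⌉≤a+L {D} s a L refl 2D≤7L D<a+k = ≮⇒≥ λ a+L<s+k → ≡+suc⇒≰ 8 (identity s k a L)
  (+-mono-≤ (+-mono-≤ (+-mono-≤ (*-monoʳ-≤ 7 a+L<s+k) 2D≤7L) (*-monoʳ-≤ 7 D<a+k))
            (*-monoʳ-≤ 2 (m/n*n≤m (D + 6) 7)))
  where
  k : ℕ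
  k = (D + 6) / 7
  identity : ∀ s k a L → 7 * suc (a + L) + 2 * suc s + 7 * suc (suc s) + 2 * (k * 7)
                         ≡ (7 * (s + k) + 7 * L + 7 * (a + k) + 2 * (suc s + 6)) + 9
  identity = solve-∀

⌈8s/7⌉≤a+L : ∀ {D} s a L → D ≡ suc s → 7 * D / 8 < a → 2 * D ≤ 7 * L → (8 * s + 6) / 7 ≤ a + L
⌈8s/7⌉≤a+L {D} s a L refl q<a 2D≤7L = ≮⇒≥ λ a+L<m → ≡+suc⇒≰ (s + 79) (identity s q a L m)
  (+-mono-≤ (+-mono-≤ (+-mono-≤ (+-mono-≤ (*-monoʳ-≤ 56 a+L<m) (*-monoʳ-≤ 8 (m/n*n≤m (8 * s + 6) 7)))
                                (*-monoʳ-≤ 56 q<a)) (*-monoʳ-≤ 7 (n<[1+n/k]*k (7 * D) 8)))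
            (*-monoʳ-≤ 8 2D≤7L))
  where
  q m : ℕ
  q = 7 * D / 8
  m = (8 * s + 6) / 7
  identity : ∀ s q a L m → 56 * suc (a + L) + 8 * (m * 7) + 56 * suc q + 7 * suc (7 * suc s) + 8 * (2 * suc s)
                           ≡ (56 * m + 8 * (8 * s + 6) + 56 * a + 7 * (suc q * 8) + 8 * (7 * L)) + suc (s + 79)
  identity = solve-∀

s<⌈8s/7⌉ : ∀ {s} → 1 ≤ s → s < (8 * s + 6) / 7
s<⌈8s/7⌉ {s} 1≤s = ≮⇒≥ λ m<1+s → ≡+suc⇒≰ 0 (identity s m)
  (+-mono-≤ (+-mono-≤ (n<[1+n/k]*k (8 * s + 6) 7) (*-monoʳ-≤ 7 m<1+s)) 1≤s)
  where
  m : ℕ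
  m = (8 * s + 6) / 7
  identity : ∀ s m → suc (8 * s + 6) + 7 * suc m + 1 ≡ (suc m * 7 + 7 * suc s + s) + 1
  identity = solve-∀

⌊7⌈8s/7⌉/8⌋≡s : ∀ s → 7 * ((8 * s + 6) / 7) / 8 ≡ s
⌊7⌈8s/7⌉/8⌋≡s s = /-≡-intro (7 * m) 8 s
  (≮⇒≥ λ 7m<8s → ≡+suc⇒≰ 0 (lower s m) (+-mono-≤ (n<[1+n/k]*k (8 * s + 6) 7) 7m<8s))
  (≰⇒> λ 8[1+s]≤7m → ≡+suc⇒≰ 1 (upper s m) (+-mono-≤ (m/n*n≤m (8 * s + 6) 7) 8[1+s]≤7m))
  where
  m : ℕ
  m = (8 * s + 6) / 7
  lower : ∀ s m → suc (8 * s + 6) + suc (7 * m) ≡ (suc m * 7 + s * 8) + 1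
  lower = solve-∀
  upper : ∀ s m → m * 7 + suc s * 8 ≡ (8 * s + 6 + 7 * m) + 2
  upper = solve-∀

iter-+ : ∀ {A : Set} (f : A → A) m k x → iter (m + k) f x ≡ iter m f (iter k f x)
iter-+ f zero    k x = refl
iter-+ f (suc m) k x = cong f (iter-+ f m k x)

module Rooted {n} (G : Setting n) (u : Fin n) (u∈V : Setting.terminal G u ≡ true) where
  open Setting G

  d : Fin n → ℕ
  d = depth u

  infix 4 _≼_
  _≼_ : Fin n → Fin n → Set
  _≼_ = Anc G u

  ≼⇒depth≤ : ∀ {a b} → a ≼ b → d a ≤ d b
  ≼⇒depth≤ (_ , _ , da≤db , _) = da≤db

  0<depth⇒≢root : ∀ {x} → 0 < d x → x ≢ u
  0<depth⇒≢root 0<dx refl = <⇒≢ 0<dx (sym (root-depth u u∈V))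

  depth-parent : ∀ {x} → InTu G u x → x ≢ u → d x ≡ suc (d (parent u x))
  depth-parent x∈T x≢u = proj₂ (proj₂ (parent-ok u u∈V _ x∈T x≢u))

  iter-parent : ∀ {x} → InTu G u x → ∀ k → k ≤ d x →
                InTu G u (iter k (parent u) x) × d (iter k (parent u) x) ≡ d x ∸ k
  iter-parent x∈T zero    _    = x∈T , refl
  iter-parent {x} x∈T (suc k) k<dx with iter-parent x∈T k (<⇒≤ k<dx)
  ... | y∈T , dy≡dx∸k = proj₁ (parent-ok u u∈V _ y∈T y≢u) , (begin
    d (parent u y)  ≡⟨ cong pred (depth-parent y∈T y≢u) ⟨
    pred (d y)      ≡⟨ cong pred dy≡dx∸k ⟩
    pred (d x ∸ k)  ≡⟨ pred[m∸n]≡m∸[1+n] (d x) k ⟩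
    d x ∸ suc k     ∎)
    where
    open ≡-Reasoning
    y : Fin n
    y = iter k (parent u) x
    y≢u : y ≢ u
    y≢u = 0<depth⇒≢root (subst (0 <_) (sym dy≡dx∸k) (m<n⇒0<n∸m k<dx))

  -- For x ∈ T_u the last component of  a ≼ x  says exactly  ancestorAt (d a) x ≡ a.
  ancestorAt : ℕ → Fin n → Fin n
  ancestorAt k x = iter (d x ∸ k) (parent u) x

  depth-ancestorAt : ∀ {x k} → InTu G u x → k ≤ d x → d (ancestorAt k x) ≡ k
  depth-ancestorAt {x} {k} x∈T k≤dx =
    trans (proj₂ (iter-parent x∈T (d x ∸ k) (m∸n≤m (d x) k))) (m∸[m∸n]≡n k≤dx)

  ancestorAt-≼ : ∀ {x k} → InTu G u x → k ≤ d x → ancestorAt k x ≼ x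
  ancestorAt-≼ {x} {k} x∈T k≤dx =
    proj₁ (iter-parent x∈T (d x ∸ k) (m∸n≤m (d x) k)) , x∈T ,
    subst (_≤ d x) (sym dk) k≤dx , cong (λ j → ancestorAt j x) dk
    where
    dk : d (ancestorAt k x) ≡ k
    dk = depth-ancestorAt x∈T k≤dx

  ancestorAt-ancestorAt : ∀ {x i j} → InTu G u x → i ≤ j → j ≤ d x →
                          ancestorAt i (ancestorAt j x) ≡ ancestorAt i x
  ancestorAt-ancestorAt {x} {i} {j} x∈T i≤j j≤dx = begin
    iter (d (ancestorAt j x) ∸ i) (parent u) (iter (d x ∸ j) (parent u) x)
      ≡⟨ cong (λ k → iter (k ∸ i) (parent u) (ancestorAt j x)) (depth-ancestorAt x∈T j≤dx) ⟩
    iter (j ∸ i) (parent u) (iter (d x ∸ j) (parent u) x)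
      ≡⟨ iter-+ (parent u) (j ∸ i) (d x ∸ j) x ⟨
    iter ((j ∸ i) + (d x ∸ j)) (parent u) x
      ≡⟨ cong (λ k → iter k (parent u) x) (∸-+-∸ i≤j j≤dx) ⟩
    iter (d x ∸ i) (parent u) x
      ∎
    where open ≡-Reasoning

  ≼-refl : ∀ {x} → InTu G u x → x ≼ x
  ≼-refl {x} x∈T = x∈T , x∈T , ≤-refl , cong (λ j → iter j (parent u) x) (n∸n≡0 (d x))

  ≼-trans : ∀ {a b c} → a ≼ b → b ≼ c → a ≼ c
  ≼-trans {a} {b} {c} (a∈T , _ , da≤db , b↑a) (_ , c∈T , db≤dc , c↑b) =
    a∈T , c∈T , ≤-trans da≤db db≤dc , (begin
      ancestorAt (d a) c                 ≡⟨ ancestorAt-ancestorAt c∈T da≤db db≤dc ⟨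
      ancestorAt (d a) (ancestorAt (d b) c) ≡⟨ cong (ancestorAt (d a)) c↑b ⟩
      ancestorAt (d a) b                 ≡⟨ b↑a ⟩
      a                                  ∎)
    where open ≡-Reasoning

  ≼-by-depth : ∀ {a c x} → a ≼ x → c ≼ x → d a ≤ d c → a ≼ c
  ≼-by-depth {a} {c} {x} (a∈T , x∈T , _ , x↑a) (c∈T , _ , dc≤dx , x↑c) da≤dc =
    a∈T , c∈T , da≤dc , (begin
      ancestorAt (d a) c                 ≡⟨ cong (ancestorAt (d a)) x↑c ⟨
      ancestorAt (d a) (ancestorAt (d c) x) ≡⟨ ancestorAt-ancestorAt x∈T da≤dc dc≤dx ⟩
      ancestorAt (d a) x                 ≡⟨ x↑a ⟩
      a                                  ∎)
    where open ≡-Reasoning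

  ≼∧depth≡⇒≡ : ∀ {a c} → a ≼ c → d a ≡ d c → a ≡ c
  ≼∧depth≡⇒≡ {c = c} (_ , _ , _ , c↑a) da≡dc =
    trans (sym c↑a) (cong (λ j → iter j (parent u) c) (trans (cong (d c ∸_) da≡dc) (n∸n≡0 (d c))))

  ≼∧≢⇒depth< : ∀ {a c} → a ≼ c → c ≢ a → d a < d c
  ≼∧≢⇒depth< a≼c c≢a = ≤∧≢⇒< (≼⇒depth≤ a≼c) (λ da≡dc → c≢a (sym (≼∧depth≡⇒≡ a≼c da≡dc)))

  parent-≼ : ∀ {c} → InTu G u c → c ≢ u → parent u c ≼ c
  parent-≼ {c} c∈T c≢u with parent-ok u u∈V c c∈T c≢u
  ... | pc∈T , _ , dc≡1+dpc =
    pc∈T , c∈T , subst (d (parent u c) ≤_) (sym dc≡1+dpc) (n≤1+n _) ,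
    cong (λ j → iter j (parent u) c)
         (trans (cong (_∸ d (parent u c)) dc≡1+dpc) (m+n∸n≡m 1 (d (parent u c))))

  depth≡0⇒root : ∀ {x} → InTu G u x → d x ≡ 0 → x ≡ u
  depth≡0⇒root {x} x∈T dx≡0 with x ≟ u
  ... | yes x≡u = x≡u
  ... | no  x≢u = contradiction (trans (sym dx≡0) (depth-parent x∈T x≢u)) 0≢1+n

  root-≼ : ∀ {x} → InTu G u x → u ≼ x
  root-≼ {x} x∈T = subst (_≼ x) (depth≡0⇒root (proj₁ x₀≼x) (depth-ancestorAt x∈T z≤n)) x₀≼x
    where
    x₀≼x : ancestorAt 0 x ≼ x
    x₀≼x = ancestorAt-≼ x∈T z≤n

  -- The multiple-of-12 assumption for the path P_u(u,v), whose top vertex is the root.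
  12∣depth : TreeAssumptions G → ∀ {v} → terminal v ≡ true → 12 ∣ d v
  12∣depth TA {v} v∈V =
    subst (λ t → 12 ∣ t + d v ∸ 2 * t) (root-depth u u∈V)
          (TreeAssumptions.mult12 TA u u v u∈V u∈V v∈V u lca)
    where
    lca : IsLCA G u u u v
    lca = ≼-refl (root-in u u∈V) , root-≼ (V⊆T u u∈V v v∈V) , λ _ c≼u _ → ≼⇒depth≤ c≼u

  star-of-deep-descendant : ∀ {w v} → w ≼ v → 3 * d w ≤ 2 * d v → Star G u w
  star-of-deep-descendant {v = v} w≼v@(w∈T , _) 3dw≤2dv =
    w∈T , λ r reach → 3a≤2b∧b∸a≤r⇒a≤2r 3dw≤2dv (proj₂ reach v (w≼v , λ _ _ z≼v → proj₁ z≼v))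

  descPathStar-ends : ∀ {a b} → DescPathStar G u a b → Star G u a × Star G u b
  descPathStar-ends (a≼b@(a∈T , b∈T , _) , star) = star _ (≼-refl a∈T) a≼b , star _ a≼b (≼-refl b∈T)

  inPath-mono : ∀ {a a' b b' c} → a ≼ a' → b' ≼ b → InPath G u a' b' c → InPath G u a b c
  inPath-mono a≼a' b'≼b (a'≼c , c≼b' , c≢a') =
    ≼-trans a≼a' a'≼c , ≼-trans c≼b' b'≼b ,
    λ c≡a → <⇒≢ (≤-<-trans (≼⇒depth≤ a≼a') (≼∧≢⇒depth< a'≼c c≢a')) (cong d (sym c≡a))

  module _ (ρ : Fin n → Fin n → ℚ) where

    subpath : ∀ {a a' b b' c} → DescPathStar G u a b → ArgMin G ρ u a b c →
              a ≼ a' → b' ≼ b → InPath G u a' b' c →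
              DescPathStar G u a' b' × ArgMin G ρ u a' b' c
    subpath (_ , star) (_ , minimal) a≼a' b'≼b c∈P'@(a'≼c , c≼b' , _) =
      (≼-trans a'≼c c≼b' , λ z a'≼z z≼b' → star z (≼-trans a≼a' a'≼z) (≼-trans z≼b' b'≼b)) ,
      c∈P' , λ c' c'∈P' → minimal c' (inPath-mono a≼a' b'≼b c'∈P')

    module Central {v q} (v∈T : InTu G u v) (dv≡12q : d v ≡ 12 * q) where

      below-v : ∀ k → k ≤ 12 → k * q ≤ d v
      below-v k k≤12 = subst (k * q ≤_) (sym dv≡12q) (*-monoˡ-≤ q k≤12)

      a b z : Fin n
      a = ancestorAt (5 * q) v
      b = ancestorAt (7 * q) v
      z = ancestorAt (8 * q) v

      a≼v : a ≼ v
      a≼v = ancestorAt-≼ v∈T (below-v 5 (m≤m+n 5 7))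
      b≼v : b ≼ v
      b≼v = ancestorAt-≼ v∈T (below-v 7 (m≤m+n 7 5))
      z≼v : z ≼ v
      z≼v = ancestorAt-≼ v∈T (below-v 8 (m≤m+n 8 4))
      da≡5q : d a ≡ 5 * q
      da≡5q = depth-ancestorAt v∈T (below-v 5 (m≤m+n 5 7))
      db≡7q : d b ≡ 7 * q
      db≡7q = depth-ancestorAt v∈T (below-v 7 (m≤m+n 7 5))
      dz≡8q : d z ≡ 8 * q
      dz≡8q = depth-ancestorAt v∈T (below-v 8 (m≤m+n 8 4))

      7q≤8q : 7 * q ≤ 8 * q
      7q≤8q = *-monoˡ-≤ q (n≤1+n 7)

      star-above-8q : ∀ {w} → w ≼ v → d w ≤ 8 * q → Star G u w
      star-above-8q {w} w≼v dw≤8q = star-of-deep-descendant w≼v (begin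
        3 * d w        ≤⟨ *-monoʳ-≤ 3 dw≤8q ⟩
        3 * (8 * q)    ≡⟨ *-assoc 3 8 q ⟨
        24 * q         ≡⟨ *-assoc 2 12 q ⟩
        2 * (12 * q)   ≡⟨ cong (2 *_) dv≡12q ⟨
        2 * d v        ∎)
        where open ≤-Reasoning

      in-twelfths : ∀ k → k * d v ≡ 12 * (k * q)
      in-twelfths k = begin
        k * d v         ≡⟨ cong (k *_) dv≡12q ⟩
        k * (12 * q)    ≡⟨ *-assoc k 12 q ⟨
        k * 12 * q      ≡⟨ cong (_* q) (*-comm k 12) ⟩
        12 * k * q      ≡⟨ *-assoc 12 k q ⟩
        12 * (k * q)    ∎
        where open ≡-Reasoning

      central⇒inPath : ∀ {c} → InCentral G ρ u v c → InPath G u a b c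
      central⇒inPath {c} (c≼v , lo , hi) =
        ≼-by-depth a≼v c≼v (≤-trans (≤-reflexive da≡5q) (<⇒≤ 5q<dc)) ,
        ≼-by-depth c≼v b≼v (≤-trans dc≤7q (≤-reflexive (sym db≡7q))) ,
        λ c≡a → <⇒≢ 5q<dc (sym (trans (cong d c≡a) da≡5q))
        where
        5q<dc : 5 * q < d c
        5q<dc = *-cancelˡ-< 12 (5 * q) (d c) (≤-trans (≤-reflexive (cong suc (sym (in-twelfths 5)))) lo)
        dc≤7q : d c ≤ 7 * q
        dc≤7q = *-cancelˡ-≤ 12 (≤-trans hi (≤-reflexive (in-twelfths 7)))

      inPath⇒central : ∀ {c} → InPath G u a b c → InCentral G ρ u v c
      inPath⇒central (a≼c , c≼b , c≢a) =
        ≼-trans c≼b b≼v ,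
        ≤-trans (≤-reflexive (cong suc (in-twelfths 5)))
                (*-monoʳ-< 12 (≤-trans (≤-reflexive (cong suc (sym da≡5q))) (≼∧≢⇒depth< a≼c c≢a))) ,
        ≤-trans (*-monoʳ-≤ 12 (≤-trans (≼⇒depth≤ c≼b) (≤-reflexive db≡7q))) (≤-reflexive (sym (in-twelfths 7)))

      module _ {c} (c∈P : InPath G u a b c) where

        dc≤7q : d c ≤ 7 * q
        dc≤7q = ≤-trans (≼⇒depth≤ (proj₁ (proj₂ c∈P))) (≤-reflexive db≡7q)

        c≼v : c ≼ v
        c≼v = ≼-trans (proj₁ (proj₂ c∈P)) b≼v

        c≢u : c ≢ u
        c≢u = 0<depth⇒≢root (≤-<-trans z≤n (≼∧≢⇒depth< (proj₁ c∈P) (proj₂ (proj₂ c∈P))))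

        central-starEdge : StarEdge G u c
        central-starEdge =
          (proj₁ c≼v , c≢u) , star-above-8q c≼v (≤-trans dc≤7q 7q≤8q) ,
          star-above-8q (≼-trans pc≼c c≼v) (≤-trans (≼⇒depth≤ pc≼c) (≤-trans dc≤7q 7q≤8q))
          where
          pc≼c : parent u c ≼ c
          pc≼c = parent-≼ (proj₁ c≼v) c≢u

        central-reach : ∀ r → Reach G u (Star G u) c r → d c ≤ 7 * r
        central-reach r reach =
          ≤-trans dc≤7q (*-monoʳ-≤ 7 (≤-trans q≤8q∸dc (subst (λ t → t ∸ d c ≤ r) dz≡8q reach-z)))
          where
          c≼z : c ≼ z
          c≼z = ≼-by-depth c≼v z≼v (≤-trans dc≤7q (≤-trans 7q≤8q (≤-reflexive (sym dz≡8q))))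
          z-below : DescIn G u (Star G u) c z
          z-below = c≼z , λ y _ y≼z →
            star-above-8q (≼-trans y≼z z≼v) (≤-trans (≼⇒depth≤ y≼z) (≤-reflexive dz≡8q))
          reach-z : d z ∸ d c ≤ r
          reach-z = proj₂ reach z z-below
          q≤8q∸dc : q ≤ 8 * q ∸ d c
          q≤8q∸dc = m+n≤o⇒m≤o∸n q (+-monoʳ-≤ q dc≤7q)

      central-descPathStar : DescPathStar G u a b
      central-descPathStar =
        ≼-by-depth a≼v b≼v (subst₂ _≤_ (sym da≡5q) (sym db≡7q) (*-monoˡ-≤ q (m≤m+n 5 2))) ,
        λ y _ y≼b → star-above-8q (≼-trans y≼b b≼v)
                                  (≤-trans (≼⇒depth≤ y≼b) (≤-trans (≤-reflexive db≡7q) 7q≤8q))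

      central-length : ∀ {c} → InPath G u a b c → 2 * d c ≤ 7 * (d b ∸ d a)
      central-length {c} c∈P = begin
        2 * d c              ≤⟨ *-monoʳ-≤ 2 (dc≤7q c∈P) ⟩
        2 * (7 * q)          ≡⟨ *-assoc 2 7 q ⟨
        14 * q               ≡⟨ *-assoc 7 2 q ⟩
        7 * (2 * q)          ≡⟨ cong (7 *_) (m+n∸m≡n (5 * q) (2 * q)) ⟨
        7 * (5 * q + 2 * q ∸ 5 * q) ≡⟨ cong (λ t → 7 * (t ∸ 5 * q)) (*-distribʳ-+ q 5 2) ⟨
        7 * (7 * q ∸ 5 * q)  ≡⟨ cong₂ (λ s t → 7 * (s ∸ t)) db≡7q da≡5q ⟨
        7 * (d b ∸ d a)      ∎
        where open ≤-Reasoning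

    η∈S⇒cond1-3 : TreeAssumptions G → ∀ {c} → InS G ρ u c →
                  StarEdge G u c × (∀ r → Reach G u (Star G u) c r → d c ≤ 7 * r) × Cond3 G ρ u c
    η∈S⇒cond1-3 TA {c} (v , v∈V , _ , c-central , c-minimal) with 12∣depth TA v∈V
    ... | divides q dv≡q*12 =
      central-starEdge c∈P , central-reach c∈P ,
      (a , b , central-descPathStar , (c∈P , λ c' c'∈P → c-minimal c' (inPath⇒central c'∈P)) ,
       central-length c∈P)
      where
      open Central {q = q} (V⊆T u u∈V v v∈V) (trans dv≡q*12 (*-comm q 12))
      c∈P : InPath G u a b c
      c∈P = central⇒inPath c-central

    module FromCond3 {a b c} (P : DescPathStar G u a b) (η-min : ArgMin G ρ u a b c)
                     (long : 2 * d c ≤ 7 * (d b ∸ d a)) where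

      a≼c : a ≼ c
      a≼c = proj₁ (proj₁ η-min)

      c≼b : c ≼ b
      c≼b = proj₁ (proj₂ (proj₁ η-min))

      c∈T : InTu G u c
      c∈T = proj₁ (proj₂ a≼c)

      b∈T : InTu G u b
      b∈T = proj₁ (proj₂ c≼b)

      da<dc : d a < d c
      da<dc = ≼∧≢⇒depth< a≼c (proj₂ (proj₂ (proj₁ η-min)))

      c≢u : c ≢ u
      c≢u = 0<depth⇒≢root (≤-<-trans z≤n da<dc)

      s : ℕ
      s = d (parent u c)

      dc≡1+s : d c ≡ suc s
      dc≡1+s = depth-parent c∈T c≢u

      da≤s : d a ≤ s
      da≤s = ≤-pred (≤-trans da<dc (≤-reflexive dc≡1+s))

      pc≼c : parent u c ≼ c
      pc≼c = parent-≼ c∈T c≢u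

      da+L≡db : d a + (d b ∸ d a) ≡ d b
      da+L≡db = m+[n∸m]≡n (≤-trans (≼⇒depth≤ a≼c) (≼⇒depth≤ c≼b))

      ending-at-η : ∀ {x} → x ≼ c → d a ≤ d x → d x < d c → DescPathStar G u x c × ArgMin G ρ u x c c
      ending-at-η x≼c da≤dx dx<dc =
        subpath P η-min (≼-by-depth a≼c x≼c da≤dx) c≼b
          (x≼c , ≼-refl c∈T , λ c≡x → <⇒≢ dx<dc (cong d (sym c≡x)))

      starting-at-η : ∀ {k} → d c ≤ k → k ≤ d b →
                      DescPathStar G u (parent u c) (ancestorAt k b) × ArgMin G ρ u (parent u c) (ancestorAt k b) c
      starting-at-η {k} dc≤k k≤db =
        subpath P η-min (≼-by-depth a≼c pc≼c da≤s) y≼b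
          (pc≼c , ≼-by-depth c≼b y≼b (≤-trans dc≤k (≤-reflexive (sym (depth-ancestorAt b∈T k≤db)))) ,
           λ c≡pc → <⇒≢ (≤-reflexive (sym dc≡1+s)) (cong d (sym c≡pc)))
        where
        y≼b : ancestorAt k b ≼ b
        y≼b = ancestorAt-≼ b∈T k≤db

      k : ℕ
      k = (d c + 6) / 7

      1≤k : 1 ≤ k
      1≤k = 1≤⌈D/7⌉ (≤-trans (s≤s z≤n) (≤-reflexive (sym dc≡1+s)))

      cond4 : Cond4 G ρ u c
      cond4 with d a + k ≤? d c
      ... | yes da+k≤dc =
        let P' , η-min' = ending-at-η (ancestorAt-≼ c∈T dc∸k≤dc) da≤dx dx<dc
        in ancestorAt (d c ∸ k) c , c , P' , η-min' , inj₂ refl ,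
           trans (cong (d c ∸_) dx≡dc∸k) (m∸[m∸n]≡n k≤dc)
        where
        k≤dc : k ≤ d c
        k≤dc = m+n≤o⇒n≤o (d a) da+k≤dc
        dc∸k≤dc : d c ∸ k ≤ d c
        dc∸k≤dc = m∸n≤m (d c) k
        dx≡dc∸k : d (ancestorAt (d c ∸ k) c) ≡ d c ∸ k
        dx≡dc∸k = depth-ancestorAt c∈T dc∸k≤dc
        da≤dx : d a ≤ d (ancestorAt (d c ∸ k) c)
        da≤dx = ≤-trans (m+n≤o⇒m≤o∸n (d a) da+k≤dc) (≤-reflexive (sym dx≡dc∸k))
        dx<dc : d (ancestorAt (d c ∸ k) c) < d c
        dx<dc = ≤-trans (≤-reflexive (cong suc dx≡dc∸k)) (∸-monoʳ-< 1≤k k≤dc)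
      ... | no ¬da+k≤dc =
        let P' , η-min' = starting-at-η dc≤s+k s+k≤db
        in parent u c , ancestorAt (s + k) b , P' , η-min' , inj₁ refl ,
           trans (cong (_∸ s) (depth-ancestorAt b∈T s+k≤db)) (m+n∸m≡n s k)
        where
        dc≤s+k : d c ≤ s + k
        dc≤s+k = ≤-trans (≤-reflexive (trans dc≡1+s (+-comm 1 s))) (+-monoʳ-≤ s 1≤k)
        s+k≤db : s + k ≤ d b
        s+k≤db = ≤-trans (s+⌈D/7⌉≤a+L s (d a) (d b ∸ d a) dc≡1+s long (≰⇒> ¬da+k≤dc)) (≤-reflexive da+L≡db)

      q : ℕ
      q = 7 * d c / 8

      cond5 : Cond5 G ρ u c
      cond5 with d a ≤? q
      ... | yes da≤q =
        let P' , η-min' = ending-at-η x≼c (≤-trans da≤q (≤-reflexive (sym dx≡q)))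
                                           (≤-trans (≤-reflexive (cong suc dx≡q)) q<dc)
            x* , c* = descPathStar-ends P'
        in x , c , x* , c* , dx≡q , proj₁ P' , η-min' , inj₂ refl
        where
        q<dc : q < d c
        q<dc = ⌊7D/8⌋<D (≤-<-trans z≤n da<dc)
        x : Fin n
        x = ancestorAt q c
        x≼c : x ≼ c
        x≼c = ancestorAt-≼ c∈T (<⇒≤ q<dc)
        dx≡q : d x ≡ q
        dx≡q = depth-ancestorAt c∈T (<⇒≤ q<dc)
      ... | no ¬da≤q =
        let P' , η-min' = starting-at-η dc≤m m≤db
            pc* , y* = descPathStar-ends P'
        in parent u c , y , pc* , y* , s≡⌊7dy/8⌋ , proj₁ P' , η-min' , inj₁ refl
        where
        m : ℕ
        m = (8 * s + 6) / 7
        m≤db : m ≤ d b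
        m≤db = ≤-trans (⌈8s/7⌉≤a+L s (d a) (d b ∸ d a) dc≡1+s (≰⇒> ¬da≤q) long) (≤-reflexive da+L≡db)
        dc≤m : d c ≤ m
        dc≤m = ≤-trans (≤-reflexive dc≡1+s)
                       (s<⌈8s/7⌉ (≤-<-trans z≤n (<-≤-trans (≰⇒> ¬da≤q) da≤s)))
        y : Fin n
        y = ancestorAt m b
        s≡⌊7dy/8⌋ : s ≡ 7 * d y / 8
        s≡⌊7dy/8⌋ = sym (trans (cong (λ t → 7 * t / 8) (depth-ancestorAt b∈T m≤db)) (⌊7⌈8s/7⌉/8⌋≡s s))

mainTheorem13 : ∀ {n} (G : Setting n) → TreeAssumptions G →
    (ρ : Fin n → Fin n → ℚ) → EdgeValues G ρ →
    ∀ u → Setting.terminal G u ≡ true →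
      (∀ c → InS G ρ u c →
          StarEdge G u c
          × (∀ r → Reach G u (Star G u) c r → Setting.depth G u c ≤ 7 * r)
          × Cond3 G ρ u c)
      × (∀ c → StarEdge G u c → Cond3 G ρ u c → Cond4 G ρ u c × Cond5 G ρ u c)
mainTheorem13 G TA ρ _ u u∈V =
  (λ _ → η∈S⇒cond1-3 ρ TA) ,
  λ { c _ (a , b , P , η-min , long) → let open FromCond3 ρ P η-min long in cond4 , cond5 }
  where open Rooted G u u∈V
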